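{- Let $k \ge 3$ be an integer and, for integers $n$ with $1 \le n \le \frac{k-1}{2}$, let $t_n = \frac{k}{k-n}\binom{k-n}{n}$. Then the maximum of $t_n$ over all integers $n$ with $1 \le n \le \frac{k-1}{2}$ is attained at $$n = m_2(k) := \left\lceil \frac{5k-4-\sqrt{5k^2-4}}{10} \right\rceil .$$ -}

module Defs where

open import Data.Nat as ℕ using (ℕ; _∸_)
open import Data.Nat.Combinatorics using (_C_)
open import Data.Integer as ℤ using (ℤ; +_)
open import Data.Rational.Unnormalised using (ℚᵘ; mkℚᵘ)
open import Data.Product using (_×_)
open import Data.Sum using (_⊎_)

-- t k n = k/(k-n) * C(k-n, n), as an (unnormalised) rational.
-- mkℚᵘ p q denotes p / (suc q); the denominator here is (k ∸ n ∸ 1) + 1 = k - n,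
-- which is correct whenever n < k (true on the range 1 ≤ n ≤ (k-1)/2).
t : ℕ → ℕ → ℚᵘ
t k n = mkℚᵘ (+ (k ℕ.* ((k ∸ n) C n))) (k ∸ n ∸ 1)

-- For an integer a and natural N:  a ≤ √N   (real square root)
LeSqrt : ℤ → ℕ → Set
LeSqrt a N = (a ℤ.≤ + 0) ⊎ (a ℤ.* a ℤ.≤ + N)

-- For natural N and integer b:  √N < b
LtSqrt : ℕ → ℤ → Set
LtSqrt N b = (+ 0 ℤ.< b) × (+ N ℤ.< b ℤ.* b)

-- m = ⌈ (5k - 4 - √(5k² - 4)) / 10 ⌉, i.e.  m - 1 < x ≤ m  with x that real number:
--   x ≤ m      ⇔  5k - 4 - 10m ≤ √(5k²-4)
--   m - 1 < x  ⇔  √(5k²-4) < 5k + 6 - 10m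
IsM2 : ℕ → ℤ → Set
IsM2 k m =
  LeSqrt (+ (5 ℕ.* k) ℤ.- + 4 ℤ.- + 10 ℤ.* m) (5 ℕ.* k ℕ.* k ∸ 4)
  × LtSqrt (5 ℕ.* k ℕ.* k ∸ 4) (+ (5 ℕ.* k) ℤ.+ + 6 ℤ.- + 10 ℤ.* m)

-- With k = 2n + 1 + s, absorption identities for binomial coefficients give
-- t_(n+1) / t_n = s (s+1) / ((n+1)(n+s)), and 20 ((n+1)(n+s) − s (s+1)) =
-- (5k² − 4) − (5s+1)².  As s = k − 2n − 1 decreases with n, the sequence t
-- increases while 5s + 1 > √(5k² − 4) and decreases from then on, so its
-- maximum sits at the least n with 5k − 4 − 10n ≤ √(5k² − 4), which is m₂(k).

module Submission where

open import Data.Nat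
open import Data.Nat.Properties
open import Data.Nat.Combinatorics using (_C_; nC1≡n; nCk+nC[k+1]≡[n+1]C[k+1])
open import Data.Nat.Combinatorics.Specification using (k>n⇒nCk≡0)
open import Data.Nat.DivMod using (m≡m%n+[m/n]*n; m%n<n; m/n*n≤m)
open import Data.Nat.Tactic.RingSolver using (solve-∀)
import Data.Integer as ℤ
open ℤ using (+_; +≤+; +<+)
open import Data.Integer.Properties using (pos-*)
import Data.Integer.Tactic.RingSolver as ℤ-Solver
open import Data.Rational.Unnormalised using (mkℚᵘ; *≤*) renaming (_≤_ to _≤ᵘ_)
import Data.Rational.Unnormalised.Properties as ℚᵘ
open import Data.Product using (Σ; ∃-syntax; _×_; _,_)
open import Data.Sum using (inj₁; inj₂)
open import Function using (_∘_)
open import Relation.Binary.Bundles using (Preorder)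
open import Relation.Binary.PropositionalEquality
open import Relation.Nullary using (¬_; yes; no; contradiction)
open import Relation.Unary using (Decidable)
open import Defs

first-crossing : ∀ {p} {P : ℕ → Set p} → Decidable P →
                 ∀ h → ¬ P 0 → P h → ∃[ n ] n < h × ¬ P n × P (suc n)
first-crossing P? zero    ¬P0 P0   = contradiction P0 ¬P0
first-crossing P? (suc h) ¬P0 P1+h with P? h
... | no ¬Ph = h , ≤-refl , ¬Ph , P1+h
... | yes Ph with first-crossing P? h ¬P0 Ph
...   | n , n<h , ¬Pn , P1+n = n , m<n⇒m<1+n n<h , ¬Pn , P1+n

module _ {a ℓ₁ ℓ₂} (P : Preorder a ℓ₁ ℓ₂) (f : ℕ → Preorder.Carrier P) where

  open Preorder P using (_≲_) renaming (refl to ≲-refl; trans to ≲-trans)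

  ascending⇒≲ : ∀ {m} → (∀ {n} → n < m → f n ≲ f (suc n)) → ∀ {n} → n ≤′ m → f n ≲ f m
  ascending⇒≲ up ≤′-refl        = ≲-refl
  ascending⇒≲ up (≤′-step n≤′m) = ≲-trans (ascending⇒≲ (up ∘ m<n⇒m<1+n) n≤′m) (up ≤-refl)

  descending⇒≲ : ∀ {m h} → (∀ {n} → m ≤ n → n < h → f (suc n) ≲ f n) → ∀ {n} → m ≤′ n → n ≤ h → f n ≲ f m
  descending⇒≲ down ≤′-refl        _     = ≲-refl
  descending⇒≲ down (≤′-step m≤′n) 1+n≤h = ≲-trans (down (≤′⇒≤ m≤′n) 1+n≤h) (descending⇒≲ down m≤′n (<⇒≤ 1+n≤h))

  unimodal⇒≲ : ∀ {m h} → (∀ {n} → n < m → f n ≲ f (suc n)) → (∀ {n} → m ≤ n → n < h → f (suc n) ≲ f n) →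
               ∀ {n} → n ≤ h → f n ≲ f m
  unimodal⇒≲ {m} up down {n} n≤h with ≤-total n m
  ... | inj₁ n≤m = ascending⇒≲ up (≤⇒≤′ n≤m)
  ... | inj₂ m≤n = descending⇒≲ down (≤⇒≤′ m≤n) n≤h

[k+1]*[n+1]C[k+1]≡[n+1]*nCk : ∀ n k → suc k * (suc n C suc k) ≡ suc n * (n C k)
[k+1]*[n+1]C[k+1]≡[n+1]*nCk n zero rewrite nC1≡n (suc n) = *-comm 1 (suc n)
[k+1]*[n+1]C[k+1]≡[n+1]*nCk zero (suc k)
  rewrite k>n⇒nCk≡0 {1} {suc (suc k)} (s≤s (s≤s z≤n)) = *-zeroʳ (suc (suc k))
[k+1]*[n+1]C[k+1]≡[n+1]*nCk (suc n) (suc k) = begin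
  suc (suc k) * (suc (suc n) C suc (suc k))
    ≡⟨ cong (suc (suc k) *_) (nCk+nC[k+1]≡[n+1]C[k+1] (suc n) (suc k)) ⟨
  suc (suc k) * (A + B)
    ≡⟨ split k A B ⟩
  suc k * A + A + suc (suc k) * B
    ≡⟨ cong₂ (λ x y → x + A + y) ([k+1]*[n+1]C[k+1]≡[n+1]*nCk n k) ([k+1]*[n+1]C[k+1]≡[n+1]*nCk n (suc k)) ⟩
  suc n * (n C k) + A + suc n * (n C suc k)
    ≡⟨ merge (suc n) A (n C k) (n C suc k) ⟩
  suc n * (n C k + n C suc k) + A
    ≡⟨ cong (λ x → suc n * x + A) (nCk+nC[k+1]≡[n+1]C[k+1] n k) ⟩
  suc n * A + A
    ≡⟨ +-comm (suc n * A) A ⟩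
  suc (suc n) * A ∎
  where
  open ≡-Reasoning
  A = suc n C suc k
  B = suc n C suc (suc k)
  split : ∀ k a b → suc (suc k) * (a + b) ≡ suc k * a + a + suc (suc k) * b
  split = solve-∀
  merge : ∀ m a c d → m * c + a + m * d ≡ m * (c + d) + a
  merge = solve-∀

[k+1]*[j+k]C[k+1]≡j*[j+k]Ck : ∀ j k → suc k * ((j + k) C suc k) ≡ j * ((j + k) C k)
[k+1]*[j+k]C[k+1]≡j*[j+k]Ck j k = +-cancelˡ-≡ (suc k * c) _ _ (begin
  suc k * c + suc k * ((j + k) C suc k) ≡⟨ *-distribˡ-+ (suc k) c _ ⟨
  suc k * (c + (j + k) C suc k)         ≡⟨ cong (suc k *_) (nCk+nC[k+1]≡[n+1]C[k+1] (j + k) k) ⟩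
  suc k * (suc (j + k) C suc k)         ≡⟨ [k+1]*[n+1]C[k+1]≡[n+1]*nCk (j + k) k ⟩
  suc (j + k) * c                       ≡⟨ cong (λ x → suc x * c) (+-comm j k) ⟩
  (suc k + j) * c                       ≡⟨ *-distribʳ-+ c (suc k) j ⟩
  suc k * c + j * c                     ∎)
  where
  open ≡-Reasoning
  c = (j + k) C k

*-cancelˡ-≤-via : ∀ u {a b c d w} .{{_ : NonZero u}} →
                  u * a ≡ c * w → u * b ≡ d * w → c ≤ d → a ≤ b
*-cancelˡ-≤-via u ua≡cw ub≡dw c≤d =
  *-cancelˡ-≤ u (subst₂ _≤_ (sym ua≡cw) (sym ub≡dw) (*-monoˡ-≤ _ c≤d))

-- With N = s + n, the ratio t_(n+1) / t_n is C(N, n+1) (N+1) / (C(N+1, n) N);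
-- multiplying both sides of its comparison with 1 by (n+1)(s+1) leaves
-- s (s+1) versus (n+1) N, times the common factor (N+1) C(N, n).
module _ (n s : ℕ) where

  private
    c : ℕ
    c = (s + n) C n

    lower-cleared : (suc n * suc s) * (((s + n) C suc n) * suc (s + n)) ≡ (s * suc s) * (suc (s + n) * c)
    lower-cleared = begin
      (suc n * suc s) * (((s + n) C suc n) * suc (s + n)) ≡⟨ swap (suc n) (suc s) _ (suc (s + n)) ⟩
      (suc s * suc (s + n)) * (suc n * ((s + n) C suc n)) ≡⟨ cong (suc s * suc (s + n) *_) ([k+1]*[j+k]C[k+1]≡j*[j+k]Ck s n) ⟩
      (suc s * suc (s + n)) * (s * c)                     ≡⟨ regroup s (suc s) (suc (s + n)) c ⟩
      (s * suc s) * (suc (s + n) * c)                     ∎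
      where
      open ≡-Reasoning
      swap : ∀ a b x d → (a * b) * (x * d) ≡ (b * d) * (a * x)
      swap = solve-∀
      regroup : ∀ a b d x → (b * d) * (a * x) ≡ (a * b) * (d * x)
      regroup = solve-∀

    upper-cleared : (suc n * suc s) * ((suc (s + n) C n) * (s + n)) ≡ (suc n * (s + n)) * (suc (s + n) * c)
    upper-cleared = begin
      (suc n * suc s) * ((suc (s + n) C n) * (s + n)) ≡⟨ swap (suc n) (suc s) _ (s + n) ⟩
      (suc n * (s + n)) * (suc s * (suc (s + n) C n)) ≡⟨ cong (suc n * (s + n) *_) [s+1]*[s+n+1]Cn≡[s+n+1]*[s+n]Cn ⟩
      (suc n * (s + n)) * (suc (s + n) * c)           ∎
      where
      open ≡-Reasoning
      swap : ∀ a b x d → (a * b) * (x * d) ≡ (a * d) * (b * x)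
      swap = solve-∀
      [s+1]*[s+n+1]Cn≡[s+n+1]*[s+n]Cn : suc s * (suc (s + n) C n) ≡ suc (s + n) * c
      [s+1]*[s+n+1]Cn≡[s+n+1]*[s+n]Cn =
        trans (sym ([k+1]*[j+k]C[k+1]≡j*[j+k]Ck (suc s) n)) ([k+1]*[n+1]C[k+1]≡[n+1]*nCk (s + n) n)

  binomial-ratio-≤ : s * suc s ≤ suc n * (s + n) →
                     ((s + n) C suc n) * suc (s + n) ≤ (suc (s + n) C n) * (s + n)
  binomial-ratio-≤ = *-cancelˡ-≤-via (suc n * suc s) lower-cleared upper-cleared

  binomial-ratio-≥ : suc n * (s + n) ≤ s * suc s →
                     (suc (s + n) C n) * (s + n) ≤ ((s + n) C suc n) * suc (s + n)
  binomial-ratio-≥ = *-cancelˡ-≤-via (suc n * suc s) upper-cleared lower-cleared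

t-expand : ∀ {k} n r → k ≡ n + r → t k n ≡ mkℚᵘ (+ (k * (r C n))) (r ∸ 1)
t-expand n r refl rewrite m+n∸m≡n n r = refl

mkℚᵘ-*ˡ-mono-≤ : ∀ c {a b} d₁ d₂ .{{_ : NonZero d₁}} .{{_ : NonZero d₂}} → a * d₂ ≤ b * d₁ →
                 mkℚᵘ (+ (c * a)) (d₁ ∸ 1) ≤ᵘ mkℚᵘ (+ (c * b)) (d₂ ∸ 1)
mkℚᵘ-*ˡ-mono-≤ c {a} {b} d₁@(suc _) d₂@(suc _) ad₂≤bd₁ =
  *≤* (subst₂ ℤ._≤_ (pos-* (c * a) d₂) (pos-* (c * b) d₁)
        (+≤+ (subst₂ _≤_ (sym (*-assoc c a d₂)) (sym (*-assoc c b d₁)) (*-monoʳ-≤ c ad₂≤bd₁))))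

≤-cross-cancel : ∀ {a b c d} → a ≤ b → a + c ≡ b + d → d ≤ c
≤-cross-cancel {a} {b} {c} {d} a≤b a+c≡b+d =
  +-cancelˡ-≤ b d c (subst (_≤ b + c) a+c≡b+d (+-monoˡ-≤ c a≤b))

-- 5k² − ((5s+1)² + 4) = 20 ((n+1)(s+n) − s(s+1)) for k = 2n + 1 + s, with the
-- subtractions moved across.
discriminant-identity : ∀ n s → let k = suc (n + n + s) in
  (1 + 5 * s) * (1 + 5 * s) + 4 + 20 * (suc n * (s + n)) ≡ 5 * k * k + 20 * (s * suc s)
discriminant-identity = solve-∀

module _ {k : ℕ} (n s : ℕ) .{{_ : NonZero s}} (k≡2n+1+s : suc (n + n + s) ≡ k) where

  private
    instance
      s+n≢0 : NonZero (s + n)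
      s+n≢0 = >-nonZero (<-≤-trans (>-nonZero⁻¹ s) (m≤m+n s n))

    discriminant : (1 + 5 * s) * (1 + 5 * s) + 4 + 20 * (suc n * (s + n)) ≡ 5 * k * k + 20 * (s * suc s)
    discriminant = subst (λ x → _ ≡ 5 * x * x + _) k≡2n+1+s (discriminant-identity n s)

    t[n+1]≡ : t k (suc n) ≡ mkℚᵘ (+ (k * ((s + n) C suc n))) (s + n ∸ 1)
    t[n+1]≡ = t-expand (suc n) (s + n) (trans (sym k≡2n+1+s) (shift n s))
      where shift : ∀ n s → suc (n + n + s) ≡ suc n + (s + n)
            shift = solve-∀

    t[n]≡ : t k n ≡ mkℚᵘ (+ (k * (suc (s + n) C n))) (s + n)
    t[n]≡ = t-expand n (suc (s + n)) (trans (sym k≡2n+1+s) (shift n s))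
      where shift : ∀ n s → suc (n + n + s) ≡ n + suc (s + n)
            shift = solve-∀

  t[n+1]≤t[n] : (1 + 5 * s) * (1 + 5 * s) + 4 ≤ 5 * k * k → t k (suc n) ≤ᵘ t k n
  t[n+1]≤t[n] D≤5k² = subst₂ _≤ᵘ_ (sym t[n+1]≡) (sym t[n]≡)
    (mkℚᵘ-*ˡ-mono-≤ k (s + n) (suc (s + n))
      (binomial-ratio-≤ n s (*-cancelˡ-≤ 20 (≤-cross-cancel D≤5k² discriminant))))

  t[n]≤t[n+1] : 5 * k * k ≤ (1 + 5 * s) * (1 + 5 * s) + 4 → t k n ≤ᵘ t k (suc n)
  t[n]≤t[n+1] 5k²≤D = subst₂ _≤ᵘ_ (sym t[n]≡) (sym t[n+1]≡)
    (mkℚᵘ-*ˡ-mono-≤ k (suc (s + n)) (s + n)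
      (binomial-ratio-≥ n s (*-cancelˡ-≤ 20 (≤-cross-cancel 5k²≤D (sym discriminant)))))

5k-4-10m≡1+5s : ∀ m s → let k = suc (m + m + s) in + (5 * k) ℤ.- + 4 ℤ.- + 10 ℤ.* + m ≡ + (1 + 5 * s)
5k-4-10m≡1+5s m s = trans (polynomial (+ m) (+ s)) (cong (ℤ._+_ (+ 1)) (sym (pos-* 5 s)))
  where polynomial : ∀ m s → + 5 ℤ.* (+ 1 ℤ.+ (m ℤ.+ m ℤ.+ s)) ℤ.- + 4 ℤ.- + 10 ℤ.* m ≡ + 1 ℤ.+ + 5 ℤ.* s
        polynomial = ℤ-Solver.solve-∀

5k+6-10[m+1]≡1+5s : ∀ m s → let k = suc (m + m + s) in + (5 * k) ℤ.+ + 6 ℤ.- + 10 ℤ.* + suc m ≡ + (1 + 5 * s)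
5k+6-10[m+1]≡1+5s m s = trans (polynomial (+ m) (+ s)) (cong (ℤ._+_ (+ 1)) (sym (pos-* 5 s)))
  where polynomial : ∀ m s → + 5 ℤ.* (+ 1 ℤ.+ (m ℤ.+ m ℤ.+ s)) ℤ.+ + 6 ℤ.- + 10 ℤ.* (+ 1 ℤ.+ m) ≡ + 1 ℤ.+ + 5 ℤ.* s
        polynomial = ℤ-Solver.solve-∀

LeSqrt-intro : ∀ {k} m s → suc (m + m + s) ≡ k → (1 + 5 * s) * (1 + 5 * s) + 4 ≤ 5 * k * k →
               LeSqrt (+ (5 * k) ℤ.- + 4 ℤ.- + 10 ℤ.* + m) (5 * k * k ∸ 4)
LeSqrt-intro m s refl D≤5k² rewrite 5k-4-10m≡1+5s m s = inj₂ (+≤+ (m+n≤o⇒m≤o∸n _ D≤5k²))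

LtSqrt-intro : ∀ {k} m s → suc (m + m + s) ≡ k → 5 * k * k < (1 + 5 * s) * (1 + 5 * s) + 4 →
               LtSqrt (5 * k * k ∸ 4) (+ (5 * k) ℤ.+ + 6 ℤ.- + 10 ℤ.* + suc m)
LtSqrt-intro m s refl 5k²<D rewrite 5k+6-10[m+1]≡1+5s m s =
  +<+ z<s , +<+ (m<n+o⇒m∸n<o (5 * k * k) 4 (subst (5 * k * k <_) (+-comm _ 4) 5k²<D))
  where k = suc (m + m + s)

m*2≡m+m : ∀ m → m * 2 ≡ m + m
m*2≡m+m m = trans (*-suc m 1) (cong (_+_ m) (*-identityʳ m))

5[a+1]²<[1+5a]²+4 : ∀ a .{{_ : NonZero a}} → 5 * suc a * suc a < (1 + 5 * a) * (1 + 5 * a) + 4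
5[a+1]²<[1+5a]²+4 a = subst (5 * suc a * suc a <_) (sym (expand a))
  (m<m+n _ (>-nonZero⁻¹ (20 * (a * a)) {{m*n≢0 20 (a * a) {{_}} {{m*n≢0 a a}}}}))
  where expand : ∀ a → (1 + 5 * a) * (1 + 5 * a) + 4 ≡ 5 * suc a * suc a + 20 * (a * a)
        expand = solve-∀

-- PastPeak n is 5k − 4 − 10n ≤ √(5k² − 4) squared, i.e. n ≥ (5k − 4 − √(5k² − 4))/10;
-- for n < h it is equivalent to t_(n+1) ≤ t_n.
module Peak (k : ℕ) (3≤k : 3 ≤ k) where

  h : ℕ
  h = (k ∸ 1) / 2

  gap : ℕ → ℕ
  gap n = k ∸ suc (n + n)

  PastPeak : ℕ → Set
  PastPeak n = (1 + 5 * gap n) * (1 + 5 * gap n) + 4 ≤ 5 * k * k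

  PastPeak? : Decidable PastPeak
  PastPeak? n = _ ≤? _

  private
    instance
      k≢0 : NonZero k
      k≢0 = >-nonZero (≤-trans (s≤s z≤n) 3≤k)

    2h+1≤k : suc (h + h) ≤ k
    2h+1≤k = subst (suc (h + h) ≤_) (suc-pred k) (s≤s (subst (_≤ k ∸ 1) (m*2≡m+m h) (m/n*n≤m (k ∸ 1) 2)))

    k≤2h+2 : k ≤ suc (h + h) + 1
    k≤2h+2 = subst (_≤ suc (h + h) + 1) (suc-pred k) (s≤s (begin
      k ∸ 1                   ≡⟨ m≡m%n+[m/n]*n (k ∸ 1) 2 ⟩
      (k ∸ 1) % 2 + h * 2     ≤⟨ +-mono-≤ (s≤s⁻¹ (m%n<n (k ∸ 1) 2)) (≤-reflexive (m*2≡m+m h)) ⟩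
      1 + (h + h)             ≡⟨ +-comm 1 (h + h) ⟩
      h + h + 1               ∎))
      where open ≤-Reasoning

  gap-spec : ∀ {n} → n ≤ h → suc (n + n + gap n) ≡ k
  gap-spec n≤h = m+[n∸m]≡n (≤-trans (s≤s (+-mono-≤ n≤h n≤h)) 2h+1≤k)

  gap-nonZero : ∀ {n} → n < h → NonZero (gap n)
  gap-nonZero n<h = >-nonZero (m<n⇒0<n∸m (≤-trans (s≤s (+-mono-< n<h n<h)) 2h+1≤k))

  PastPeak-mono : ∀ {m n} → m ≤ n → PastPeak m → PastPeak n
  PastPeak-mono m≤n = ≤-trans (+-monoˡ-≤ 4 (*-mono-≤ 1+5gap≤ 1+5gap≤))
    where 1+5gap≤ = s≤s (*-monoʳ-≤ 5 (∸-monoʳ-≤ k (s≤s (+-mono-≤ m≤n m≤n))))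

  ¬PastPeak-0 : ¬ PastPeak 0
  ¬PastPeak-0 = <⇒≱ (subst (λ x → 5 * x * x < (1 + 5 * gap 0) * (1 + 5 * gap 0) + 4) (suc-pred k)
    (5[a+1]²<[1+5a]²+4 (k ∸ 1) {{>-nonZero (m<n⇒0<n∸m (≤-trans (s≤s (s≤s z≤n)) 3≤k))}}))

  PastPeak-h : PastPeak h
  PastPeak-h = ≤-trans (+-monoˡ-≤ 4 (*-mono-≤ 1+5gap≤6 1+5gap≤6))
                       (≤-trans (m≤m+n 40 5) (*-mono-≤ (*-monoʳ-≤ 5 3≤k) 3≤k))
    where 1+5gap≤6 = s≤s (*-monoʳ-≤ 5 (m≤n+o⇒m∸n≤o k (suc (h + h)) k≤2h+2))

  t-ascends : ∀ {n} → n < h → ¬ PastPeak n → t k n ≤ᵘ t k (suc n)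
  t-ascends {n} n<h ¬Pn =
    t[n]≤t[n+1] n (gap n) {{gap-nonZero n<h}} (gap-spec (<⇒≤ n<h)) (<⇒≤ (≰⇒> ¬Pn))

  t-descends : ∀ {n} → n < h → PastPeak n → t k (suc n) ≤ᵘ t k n
  t-descends {n} n<h Pn = t[n+1]≤t[n] n (gap n) {{gap-nonZero n<h}} (gap-spec (<⇒≤ n<h)) Pn

  crossing⇒IsM2 : ∀ {n} → n < h → ¬ PastPeak n → PastPeak (suc n) → IsM2 k (+ suc n)
  crossing⇒IsM2 {n} n<h ¬Pn P[1+n] =
    LeSqrt-intro (suc n) (gap (suc n)) (gap-spec n<h) P[1+n] ,
    LtSqrt-intro n (gap n) (gap-spec (<⇒≤ n<h)) (≰⇒> ¬Pn)

  crossing⇒maximal : ∀ {n} → n < h → ¬ PastPeak n → PastPeak (suc n) →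
                     ∀ {j} → j ≤ h → t k j ≤ᵘ t k (suc n)
  crossing⇒maximal {n} n<h ¬Pn P[1+n] = unimodal⇒≲ ℚᵘ.≤-preorder (t k) ascending descending
    where
    ascending : ∀ {j} → j < suc n → t k j ≤ᵘ t k (suc j)
    ascending j≤n = t-ascends (≤-<-trans (s≤s⁻¹ j≤n) n<h) (¬Pn ∘ PastPeak-mono (s≤s⁻¹ j≤n))
    descending : ∀ {j} → suc n ≤ j → j < h → t k (suc j) ≤ᵘ t k j
    descending 1+n≤j j<h = t-descends j<h (PastPeak-mono 1+n≤j P[1+n])

mainTheorem1 : (k : ℕ) → 3 ≤ k →
    Σ ℕ (λ m → IsM2 k (+ m) × 1 ≤ m × m ≤ (k ∸ 1) / 2
    × ((n : ℕ) → 1 ≤ n → n ≤ (k ∸ 1) / 2 → t k n ≤ᵘ t k m))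
mainTheorem1 k 3≤k =
  let open Peak k 3≤k
      n , n<h , ¬Pn , P[1+n] = first-crossing PastPeak? h ¬PastPeak-0 PastPeak-h
  in suc n , crossing⇒IsM2 n<h ¬Pn P[1+n] , s≤s z≤n , n<h ,
     λ _ _ → crossing⇒maximal n<h ¬Pn P[1+n]
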